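{- If $\vdash_{\mathsf{LTL}}A$, then the 2-sequent $\vdash A^{\langle 0,\varnothing\rangle}$ is provable in $2_{\mathsf{LTL}}$.
   Context: Temporal formulas are built from proposition symbols using $\neg,\wedge,\vee,\to$, the unary operators $\Box$ (always), $\Diamond$ (sometime) and $\bigcirc$ (next). The Hilbert system $\mathsf{LTL}$ has axioms: A0 all temporal instances of classical propositional tautologies; A1 $\bigcirc(A\to B)\to(\bigcirc A\to\bigcirc B)$; A2 $\neg\bigcirc A\to\bigcirc\neg A$; A3 $\Box(A\to B)\to(\Box A\to\Box B)$; A4 $\Box A\to A$; A5 $\Box A\to\Box\Box A$; A6 $\Box A\to\bigcirc A$; A7 $\Box A\to\bigcirc\Box A$; A8 $A\wedge\Box(A\to\bigcirc A)\to\Box A$; rules: modus ponens, from $A$ infer $\bigcirc A$, from $A$ infer $\Box A$. $\vdash_{\mathsf{LTL}}A$ means $A$ is derivable. Positions for $\mathsf{LTL}$ are pairs $\langle n,S\rangle$ with $n\in\mathbb N$ and $S$ a finite set of tokens from a countably infinite set. For $s=\langle n,S\rangle$, $t=\langle m,T\rangle$: $s\oplus t=\langle n+m,S\cup T\rangle$; $s\oplus m$ means $s\oplus\langle m,\varnothing\rangle$; $s\oplus x$ means $s\oplus\langle 0,\{x\}\rangle$ for a token $x$. A p-formula is $A^s$; a 2-sequent is $\Gamma\vdash\Delta$ with $\Gamma,\Delta$ finite sequences of p-formulas; $x\notin s,\Gamma,\Delta$ means the token $x$ belongs to no position in $s,\Gamma,\Delta$. The calculus $2_{\mathsf{LTL}}$: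 Axiom $A^s\vdash A^s$; unrestricted Cut (from $\Gamma_1\vdash A^s,\Delta_1$ and $\Gamma_2,A^s\vdash\Delta_2$ infer $\Gamma_1,\Gamma_2\vdash\Delta_1,\Delta_2$); weakening, contraction, exchange; classical propositional sequent rules for $\neg,\wedge,\vee,\to$ (two-premise rules with contexts joined) with all active p-formulas at the same position; temporal rules: from $\Gamma,A^{s\oplus t}\vdash\Delta$ infer $\Gamma,(\Box A)^s\vdash\Delta$ ($t$ any position); from $\Gamma\vdash A^{s\oplus x},\Delta$ infer $\Gamma\vdash(\Box A)^s,\Delta$; from $\Gamma,A^{s\oplus x}\vdash\Delta$ infer $\Gamma,(\Diamond A)^s\vdash\Delta$; from $\Gamma\vdash A^{s\oplus t},\Delta$ infer $\Gamma\vdash(\Diamond A)^s,\Delta$ ($t$ any position); from $\Gamma,A^{s\oplus 1}\vdash\Delta$ infer $\Gamma,(\bigcirc A)^s\vdash\Delta$; from $\Gamma\vdash A^{s\oplus1},\Delta$ infer $\Gamma\vdash(\bigcirc A)^s,\Delta$; IND: from $\Gamma,A^{s\oplus x}\vdash A^{s\oplus x\oplus 1},\Delta$ infer $\Gamma,A^s\vdash A^{s\oplus t},\Delta$ ($t$ any position). In the right $\Box$ rule, the left $\Diamond$ rule and IND, $x\notin s,\Gamma,\Delta$. -}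

module Defs where

open import Data.Nat using (ℕ; zero; suc; _+_)
open import Data.Bool using (Bool; true; false; not; _∧_; _∨_)
open import Data.List using (List; []; _∷_; _++_)
open import Data.List.Relation.Unary.All using (All)
open import Data.Product using (_×_; _,_)
open import Relation.Binary.PropositionalEquality using (_≡_)

infixr 4 _⇒_
infixr 5 _∨ᶠ_
infixr 6 _∧ᶠ_

data Form : Set where
  atom  : ℕ → Form
  ¬ᶠ_   : Form → Form
  _∧ᶠ_  : Form → Form → Form
  _∨ᶠ_  : Form → Form → Form
  _⇒_   : Form → Form → Form
  □_    : Form → Form
  ◇_    : Form → Form
  ○_    : Form → Form

data PForm : Set where
  pvar : ℕ → PForm
  pneg : PForm → PForm
  pand : PForm → PForm → PForm
  por  : PForm → PForm → PForm
  pimp : PForm → PForm → PForm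

evalP : (ℕ → Bool) → PForm → Bool
evalP v (pvar p)   = v p
evalP v (pneg P)   = not (evalP v P)
evalP v (pand P Q) = evalP v P ∧ evalP v Q
evalP v (por P Q)  = evalP v P ∨ evalP v Q
evalP v (pimp P Q) = not (evalP v P) ∨ evalP v Q

Tautology : PForm → Set
Tautology P = (v : ℕ → Bool) → evalP v P ≡ true

instP : (ℕ → Form) → PForm → Form
instP σ (pvar p)   = σ p
instP σ (pneg P)   = ¬ᶠ instP σ P
instP σ (pand P Q) = instP σ P ∧ᶠ instP σ Q
instP σ (por P Q)  = instP σ P ∨ᶠ instP σ Q
instP σ (pimp P Q) = instP σ P ⇒ instP σ Q

data ⊢LTL : Form → Set where
  A0  : (P : PForm) (σ : ℕ → Form) → Tautology P → ⊢LTL (instP σ P)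
  A1  : (A B : Form) → ⊢LTL (○ (A ⇒ B) ⇒ (○ A ⇒ ○ B))
  A2  : (A : Form) → ⊢LTL (¬ᶠ (○ A) ⇒ ○ (¬ᶠ A))
  A3  : (A B : Form) → ⊢LTL (□ (A ⇒ B) ⇒ (□ A ⇒ □ B))
  A4  : (A : Form) → ⊢LTL (□ A ⇒ A)
  A5  : (A : Form) → ⊢LTL (□ A ⇒ □ (□ A))
  A6  : (A : Form) → ⊢LTL (□ A ⇒ ○ A)
  A7  : (A : Form) → ⊢LTL (□ A ⇒ ○ (□ A))
  A8  : (A : Form) → ⊢LTL ((A ∧ᶠ □ (A ⇒ ○ A)) ⇒ □ A)
  MP  : {A B : Form} → ⊢LTL A → ⊢LTL (A ⇒ B) → ⊢LTL B
  NEX : {A : Form} → ⊢LTL A → ⊢LTL (○ A)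
  NEC : {A : Form} → ⊢LTL A → ⊢LTL (□ A)

-- A nonempty finite set is its characteristic bit string, least
-- significant bit first, ending with a 1 (so each finite set has exactly
-- one representation and set equality is _≡_):
--   top  = {0},   b0 S = {i+1 | i ∈ S},   b1 S = {0} ∪ {i+1 | i ∈ S}.

data NE : Set where
  top : NE
  b0  : NE → NE
  b1  : NE → NE

data TokSet : Set where
  ∅  : TokSet
  ne : NE → TokSet

_∪NE_ : NE → NE → NE
top  ∪NE top  = top
top  ∪NE b0 t = b1 t
top  ∪NE b1 t = b1 t
b0 s ∪NE top  = b1 s
b1 s ∪NE top  = b1 s
b0 s ∪NE b0 t = b0 (s ∪NE t)
b0 s ∪NE b1 t = b1 (s ∪NE t)
b1 s ∪NE b0 t = b1 (s ∪NE t)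
b1 s ∪NE b1 t = b1 (s ∪NE t)

_∪_ : TokSet → TokSet → TokSet
∅    ∪ T    = T
ne s ∪ ∅    = ne s
ne s ∪ ne t = ne (s ∪NE t)

singNE : ℕ → NE
singNE zero    = top
singNE (suc n) = b0 (singNE n)

⟅_⟆ : ℕ → TokSet
⟅ x ⟆ = ne (singNE x)

memNE : ℕ → NE → Bool
memNE zero    top    = true
memNE (suc x) top    = false
memNE zero    (b0 s) = false
memNE (suc x) (b0 s) = memNE x s
memNE zero    (b1 s) = true
memNE (suc x) (b1 s) = memNE x s

mem : ℕ → TokSet → Bool
mem x ∅      = false
mem x (ne s) = memNE x s

record Pos : Set where
  constructor ⟨_,_⟩
  field
    num  : ℕ
    toks : TokSet
open Pos public

_⊕_ : Pos → Pos → Pos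
⟨ n , S ⟩ ⊕ ⟨ m , T ⟩ = ⟨ n + m , S ∪ T ⟩

_⊕ₙ_ : Pos → ℕ → Pos
s ⊕ₙ m = s ⊕ ⟨ m , ∅ ⟩

_⊕ₓ_ : Pos → ℕ → Pos
s ⊕ₓ x = s ⊕ ⟨ 0 , ⟅ x ⟆ ⟩

pos₀ : Pos
pos₀ = ⟨ 0 , ∅ ⟩

PF : Set
PF = Form × Pos

_^_ : Form → Pos → PF
A ^ s = A , s

FreshPos : ℕ → Pos → Set
FreshPos x s = mem x (toks s) ≡ false

FreshPF : ℕ → PF → Set
FreshPF x (A , s) = FreshPos x s

Fresh : ℕ → Pos → List PF → List PF → Set
Fresh x s Γ Δ = FreshPos x s × All (FreshPF x) Γ × All (FreshPF x) Δ

-- The calculus 2_LTL.  Sequent Γ ⊢ Δ is written  Γ ⊢₂ Δ.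
-- Active p-formulas are written at the head of the sequences; exchange
-- makes the placement immaterial.

infix 2 _⊢₂_

data _⊢₂_ : List PF → List PF → Set where
  ax   : (A : Form) (s : Pos) → (A ^ s) ∷ [] ⊢₂ (A ^ s) ∷ []
  cut  : ∀ {Γ₁ Γ₂ Δ₁ Δ₂ P} →
         Γ₁ ⊢₂ P ∷ Δ₁ → P ∷ Γ₂ ⊢₂ Δ₂ → Γ₁ ++ Γ₂ ⊢₂ Δ₁ ++ Δ₂
  wL   : ∀ {Γ Δ} P → Γ ⊢₂ Δ → P ∷ Γ ⊢₂ Δ
  wR   : ∀ {Γ Δ} P → Γ ⊢₂ Δ → Γ ⊢₂ P ∷ Δ
  cL   : ∀ {Γ Δ P} → P ∷ P ∷ Γ ⊢₂ Δ → P ∷ Γ ⊢₂ Δ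
  cR   : ∀ {Γ Δ P} → Γ ⊢₂ P ∷ P ∷ Δ → Γ ⊢₂ P ∷ Δ
  exL  : ∀ {Γ₁ Γ₂ Δ P Q} → Γ₁ ++ P ∷ Q ∷ Γ₂ ⊢₂ Δ → Γ₁ ++ Q ∷ P ∷ Γ₂ ⊢₂ Δ
  exR  : ∀ {Γ Δ₁ Δ₂ P Q} → Γ ⊢₂ Δ₁ ++ P ∷ Q ∷ Δ₂ → Γ ⊢₂ Δ₁ ++ Q ∷ P ∷ Δ₂
  ¬L   : ∀ {Γ Δ A s} → Γ ⊢₂ (A ^ s) ∷ Δ → ((¬ᶠ A) ^ s) ∷ Γ ⊢₂ Δ
  ¬R   : ∀ {Γ Δ A s} → (A ^ s) ∷ Γ ⊢₂ Δ → Γ ⊢₂ ((¬ᶠ A) ^ s) ∷ Δ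
  ∧L₁  : ∀ {Γ Δ A s} B → (A ^ s) ∷ Γ ⊢₂ Δ → ((A ∧ᶠ B) ^ s) ∷ Γ ⊢₂ Δ
  ∧L₂  : ∀ {Γ Δ B s} A → (B ^ s) ∷ Γ ⊢₂ Δ → ((A ∧ᶠ B) ^ s) ∷ Γ ⊢₂ Δ
  ∧R   : ∀ {Γ₁ Γ₂ Δ₁ Δ₂ A B s} →
         Γ₁ ⊢₂ (A ^ s) ∷ Δ₁ → Γ₂ ⊢₂ (B ^ s) ∷ Δ₂ →
         Γ₁ ++ Γ₂ ⊢₂ ((A ∧ᶠ B) ^ s) ∷ (Δ₁ ++ Δ₂)
  ∨L   : ∀ {Γ₁ Γ₂ Δ₁ Δ₂ A B s} →
         (A ^ s) ∷ Γ₁ ⊢₂ Δ₁ → (B ^ s) ∷ Γ₂ ⊢₂ Δ₂ →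
         ((A ∨ᶠ B) ^ s) ∷ (Γ₁ ++ Γ₂) ⊢₂ Δ₁ ++ Δ₂
  ∨R₁  : ∀ {Γ Δ A s} B → Γ ⊢₂ (A ^ s) ∷ Δ → Γ ⊢₂ ((A ∨ᶠ B) ^ s) ∷ Δ
  ∨R₂  : ∀ {Γ Δ B s} A → Γ ⊢₂ (B ^ s) ∷ Δ → Γ ⊢₂ ((A ∨ᶠ B) ^ s) ∷ Δ
  ⇒L   : ∀ {Γ₁ Γ₂ Δ₁ Δ₂ A B s} →
         Γ₁ ⊢₂ (A ^ s) ∷ Δ₁ → (B ^ s) ∷ Γ₂ ⊢₂ Δ₂ →
         ((A ⇒ B) ^ s) ∷ (Γ₁ ++ Γ₂) ⊢₂ Δ₁ ++ Δ₂
  ⇒R   : ∀ {Γ Δ A B s} → (A ^ s) ∷ Γ ⊢₂ (B ^ s) ∷ Δ → Γ ⊢₂ ((A ⇒ B) ^ s) ∷ Δ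
  □L   : ∀ {Γ Δ A s} t → (A ^ (s ⊕ t)) ∷ Γ ⊢₂ Δ → ((□ A) ^ s) ∷ Γ ⊢₂ Δ
  □R   : ∀ {Γ Δ A s} x → Fresh x s Γ Δ →
         Γ ⊢₂ (A ^ (s ⊕ₓ x)) ∷ Δ → Γ ⊢₂ ((□ A) ^ s) ∷ Δ
  ◇L   : ∀ {Γ Δ A s} x → Fresh x s Γ Δ →
         (A ^ (s ⊕ₓ x)) ∷ Γ ⊢₂ Δ → ((◇ A) ^ s) ∷ Γ ⊢₂ Δ
  ◇R   : ∀ {Γ Δ A s} t → Γ ⊢₂ (A ^ (s ⊕ t)) ∷ Δ → Γ ⊢₂ ((◇ A) ^ s) ∷ Δ
  ○L   : ∀ {Γ Δ A s} → (A ^ (s ⊕ₙ 1)) ∷ Γ ⊢₂ Δ → ((○ A) ^ s) ∷ Γ ⊢₂ Δ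
  ○R   : ∀ {Γ Δ A s} → Γ ⊢₂ (A ^ (s ⊕ₙ 1)) ∷ Δ → Γ ⊢₂ ((○ A) ^ s) ∷ Δ
  IND  : ∀ {Γ Δ A s} x t → Fresh x s Γ Δ →
         (A ^ (s ⊕ₓ x)) ∷ Γ ⊢₂ (A ^ ((s ⊕ₓ x) ⊕ₙ 1)) ∷ Δ →
         (A ^ s) ∷ Γ ⊢₂ (A ^ (s ⊕ t)) ∷ Δ

module Submission where

-- The claim is strengthened to every position s (the rules "from A infer
-- ○A" and "from A infer □A" shift the position) and proved by induction on
-- the LTL derivation.  Three general facts are prepared first:
--   * admissible structure: a derivable sequent stays derivable when either
--     side is replaced by any list containing all of its p-formulas; this
--     follows from exchange, contraction and weakening alone and is proved
--     once for an abstract judgement on lists;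
--   * algebra of positions: ⊕ is associative with unit ⟨0,∅⟩, and every
--     position has a fresh token, which is also fresh for its summands;
--   * propositional completeness (Kalmár's method): for each valuation the
--     literal sequent of the variables decides every formula, and for a
--     tautology the variables are removed one by one by cutting on the
--     atom, so every substitution instance of a tautology is provable.
-- The temporal axioms A1–A8 get explicit derivations, modus ponens is a
-- cut, and the two rules are the right ○ and □ rules.

open import Defs
open import Data.Nat using (ℕ; zero; suc; _≤_; s≤s; _≟_)
open import Data.Nat.Properties using (+-assoc; ≤-refl)
import Data.Nat.Properties as ℕ
open import Data.Bool using (Bool; true; false; not; if_then_else_)
import Data.Bool as Bool
open import Data.List using (List; []; _∷_; _++_; [_]; map; filter)
open import Data.List.Properties using (++-assoc; ++-identityʳ)
open import Data.List.Membership.Propositional using (_∈_)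
open import Data.List.Membership.Propositional.Properties
  using (∈-∃++; ∈-++⁻; ∈-++⁺ˡ; ∈-++⁺ʳ; ∈-map⁺; ∈-map⁻; ∈-filter⁺; ∈-filter⁻)
open import Data.List.Relation.Binary.Subset.Propositional using (_⊆_)
open import Data.List.Relation.Binary.Subset.Propositional.Properties
  using (⊆-refl; ∷⁺ʳ; ∈-∷⁺ʳ)
open import Data.List.Relation.Unary.Any using (here; there)
open import Data.List.Relation.Unary.All using ([]; _∷_)
open import Data.Product using (_×_; _,_; ∃)
open import Data.Sum using ([_,_]′)
open import Function using (id; _∘_)
open import Relation.Nullary using (yes; no; ¬_; contradiction)
open import Relation.Nullary.Decidable using (⌊_⌋)
open import Relation.Binary.PropositionalEquality
  using (_≡_; refl; sym; trans; cong; cong₂; subst)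

++-idem-⊆ : {A : Set} (xs : List A) → xs ++ xs ⊆ xs
++-idem-⊆ xs = [ id , id ]′ ∘ ∈-++⁻ xs

module Structural {A : Set} (J : List A → Set)
  (exch   : ∀ Π {P Q Γ} → J (Π ++ P ∷ Q ∷ Γ) → J (Π ++ Q ∷ P ∷ Γ))
  (contr  : ∀ {P Γ} → J (P ∷ P ∷ Γ) → J (P ∷ Γ))
  (weaken : ∀ P {Γ} → J Γ → J (P ∷ Γ))
  where

  toFront : ∀ Π Γ₁ {P Γ₂} → J (Π ++ Γ₁ ++ P ∷ Γ₂) → J (Π ++ P ∷ Γ₁ ++ Γ₂)
  toFront Π []       d = d
  toFront Π (Q ∷ Γ₁) {P} {Γ₂} d =
    exch Π (subst J (++-assoc Π [ Q ] (P ∷ Γ₁ ++ Γ₂))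
      (toFront (Π ++ [ Q ]) Γ₁ (subst J (sym (++-assoc Π [ Q ] (Γ₁ ++ P ∷ Γ₂))) d)))

  fromFront : ∀ Π Γ₁ {P Γ₂} → J (Π ++ P ∷ Γ₁ ++ Γ₂) → J (Π ++ Γ₁ ++ P ∷ Γ₂)
  fromFront Π []       d = d
  fromFront Π (Q ∷ Γ₁) {P} {Γ₂} d =
    subst J (++-assoc Π [ Q ] (Γ₁ ++ P ∷ Γ₂))
      (fromFront (Π ++ [ Q ]) Γ₁ (subst J (sym (++-assoc Π [ Q ] (P ∷ Γ₁ ++ Γ₂))) (exch Π d)))

  absorb : ∀ {P Γ} → P ∈ Γ → J (P ∷ Γ) → J Γ
  absorb {P} P∈Γ d with Γ₁ , Γ₂ , refl ← ∈-∃++ P∈Γ =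
    fromFront [] Γ₁ (contr (toFront [ P ] Γ₁ d))

  weakenMany : ∀ Θ {Γ} → J Γ → J (Θ ++ Γ)
  weakenMany []      d = d
  weakenMany (P ∷ Θ) d = weaken P (weakenMany Θ d)

  absorbTail : ∀ Γ' Θ → Θ ⊆ Γ' → J (Γ' ++ Θ) → J Γ'
  absorbTail Γ' []      _   d = subst J (++-identityʳ Γ') d
  absorbTail Γ' (P ∷ Θ) Θ⊆Γ' d =
    absorbTail Γ' Θ (Θ⊆Γ' ∘ there)
      (absorb (∈-++⁺ˡ (Θ⊆Γ' (here refl))) (toFront [] Γ' d))

  monotone : ∀ {Γ Γ'} → Γ ⊆ Γ' → J Γ → J Γ'
  monotone {Γ} {Γ'} Γ⊆Γ' d = absorbTail Γ' Γ Γ⊆Γ' (weakenMany Γ' d)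

sub : ∀ {Γ Δ Γ' Δ'} → Γ ⊆ Γ' → Δ ⊆ Δ' → Γ ⊢₂ Δ → Γ' ⊢₂ Δ'
sub {Δ = Δ} {Γ' = Γ'} Γ⊆Γ' Δ⊆Δ' d =
  Structural.monotone (Γ' ⊢₂_) (λ Π → exR {Δ₁ = Π}) cR (λ P → wR P) Δ⊆Δ'
    (Structural.monotone (_⊢₂ Δ) (λ Π → exL {Π}) cL (λ P → wL P) Γ⊆Γ' d)

vars : PForm → List ℕ
vars (pvar p)   = [ p ]
vars (pneg P)   = vars P
vars (pand P Q) = vars P ++ vars Q
vars (por P Q)  = vars P ++ vars Q
vars (pimp P Q) = vars P ++ vars Q

_[_↦_] : (ℕ → Bool) → ℕ → Bool → ℕ → Bool
(v [ x ↦ b ]) y = if ⌊ y ≟ x ⌋ then b else v y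

update-at : ∀ v x b → (v [ x ↦ b ]) x ≡ b
update-at v x b with x ≟ x
... | yes _   = refl
... | no x≢x = contradiction refl x≢x

update-off : ∀ v x b y → ¬ y ≡ x → (v [ x ↦ b ]) y ≡ v y
update-off v x b y y≢x with y ≟ x
... | yes y≡x = contradiction y≡x y≢x
... | no _    = refl

module Propositional (σ : ℕ → Form) (s : Pos) where

  ⟦_⟧ : PForm → PF
  ⟦ P ⟧ = instP σ P ^ s

  -- The instances of those variables of xs that the valuation u makes
  -- true.  The literal sequent of v is  lits v xs ⊢ lits (not ∘ v) xs.
  lits : (ℕ → Bool) → List ℕ → List PF
  lits u xs = map (λ p → ⟦ pvar p ⟧) (filter (λ p → u p Bool.≟ true) xs)

  ∈-lits⁺ : ∀ {u xs p} → p ∈ xs → u p ≡ true → ⟦ pvar p ⟧ ∈ lits u xs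
  ∈-lits⁺ {u} p∈xs up = ∈-map⁺ _ (∈-filter⁺ (λ p → u p Bool.≟ true) p∈xs up)

  ∈-lits⁻ : ∀ {u xs Q} → Q ∈ lits u xs → ∃ λ p → p ∈ xs × u p ≡ true × Q ≡ ⟦ pvar p ⟧
  ∈-lits⁻ {u} Q∈ with p , p∈ , refl ← ∈-map⁻ _ Q∈
                    with p∈xs , up ← ∈-filter⁻ (λ p → u p Bool.≟ true) p∈ =
    p , p∈xs , up , refl

  lits-agree : ∀ {u w x xs Θ} → (∀ y → ¬ y ≡ x → u y ≡ w y) →
               (u x ≡ true → ⟦ pvar x ⟧ ∈ Θ) → lits u (x ∷ xs) ⊆ Θ ++ lits w xs
  lits-agree {u} {w} {x} {Θ = Θ} agree own Q∈ with ∈-lits⁻ {u} Q∈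
  ... | p , p∈ , up , refl with p ≟ x
  ...   | yes refl = ∈-++⁺ˡ (own up)
  ...   | no p≢x with p∈
  ...     | here p≡x   = contradiction p≡x p≢x
  ...     | there p∈xs = ∈-++⁺ʳ Θ (∈-lits⁺ p∈xs (trans (sym (agree p p≢x)) up))

  Decides : (ℕ → Bool) → List ℕ → PForm → Set
  Decides v xs P =
    if evalP v P then lits v xs ⊢₂ ⟦ P ⟧ ∷ lits (not ∘ v) xs
                 else ⟦ P ⟧ ∷ lits v xs ⊢₂ lits (not ∘ v) xs

  kalmar : ∀ v xs P → vars P ⊆ xs → Decides v xs P
  kalmar v xs (pvar p) cover with v p in vp
  ... | true  = sub (∈-∷⁺ʳ (∈-lits⁺ (cover (here refl)) vp) (λ ()))
                    (∈-∷⁺ʳ (here refl) (λ ())) (ax (σ p) s)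
  ... | false = sub (∈-∷⁺ʳ (here refl) (λ ()))
                    (∈-∷⁺ʳ (∈-lits⁺ (cover (here refl)) (cong not vp)) (λ ())) (ax (σ p) s)
  kalmar v xs (pneg A) cover with evalP v A | kalmar v xs A cover
  ... | true  | ⊢A = ¬L ⊢A
  ... | false | A⊢ = ¬R A⊢
  kalmar v xs (pand A B) cover
    with evalP v A | kalmar v xs A (cover ∘ ∈-++⁺ˡ)
       | evalP v B | kalmar v xs B (cover ∘ ∈-++⁺ʳ (vars A))
  ... | true  | ⊢A | true  | ⊢B = sub (++-idem-⊆ _) (∷⁺ʳ _ (++-idem-⊆ _)) (∧R ⊢A ⊢B)
  ... | true  | _  | false | B⊢ = ∧L₂ _ B⊢
  ... | false | A⊢ | _     | _  = ∧L₁ _ A⊢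
  kalmar v xs (por A B) cover
    with evalP v A | kalmar v xs A (cover ∘ ∈-++⁺ˡ)
       | evalP v B | kalmar v xs B (cover ∘ ∈-++⁺ʳ (vars A))
  ... | true  | ⊢A | _     | _  = ∨R₁ _ ⊢A
  ... | false | _  | true  | ⊢B = ∨R₂ _ ⊢B
  ... | false | A⊢ | false | B⊢ = sub (∷⁺ʳ _ (++-idem-⊆ _)) (++-idem-⊆ _) (∨L A⊢ B⊢)
  kalmar v xs (pimp A B) cover
    with evalP v A | kalmar v xs A (cover ∘ ∈-++⁺ˡ)
       | evalP v B | kalmar v xs B (cover ∘ ∈-++⁺ʳ (vars A))
  ... | false | A⊢ | _     | _  = ⇒R (wR _ A⊢)
  ... | true  | _  | true  | ⊢B = ⇒R (wL _ ⊢B)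
  ... | true  | ⊢A | false | B⊢ = sub (∷⁺ʳ _ (++-idem-⊆ _)) (++-idem-⊆ _) (⇒L ⊢A B⊢)

  Closed : PForm → List ℕ → Set
  Closed P xs = ∀ v → lits v xs ⊢₂ ⟦ P ⟧ ∷ lits (not ∘ v) xs

  -- Cutting on the atom x (true on one side, false on the other) removes x
  -- from the literal sequents.
  eliminate : ∀ P x xs → Closed P (x ∷ xs) → Closed P xs
  eliminate P x xs closed v = sub (++-idem-⊆ _) (++-idem-⊆ _) (cut x-false x-true)
    where
      v⁺ v⁻ : ℕ → Bool
      v⁺ = v [ x ↦ true ]
      v⁻ = v [ x ↦ false ]

      negated-off : ∀ b y → ¬ y ≡ x → not ((v [ x ↦ b ]) y) ≡ not (v y)
      negated-off b y y≢x = cong not (update-off v x b y y≢x)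

      x-true : ⟦ pvar x ⟧ ∷ lits v xs ⊢₂ ⟦ P ⟧ ∷ lits (not ∘ v) xs
      x-true = sub (lits-agree (update-off v x true) (λ _ → here refl))
                   (∷⁺ʳ _ (lits-agree {Θ = []} (negated-off true)
                     (λ e → contradiction (trans (sym (cong not (update-at v x true))) e) λ ())))
                   (closed v⁺)

      x-false : lits v xs ⊢₂ ⟦ pvar x ⟧ ∷ ⟦ P ⟧ ∷ lits (not ∘ v) xs
      x-false = sub (lits-agree {Θ = []} (update-off v x false)
                      (λ e → contradiction (trans (sym (update-at v x false)) e) λ ()))
                    (∈-∷⁺ʳ (there (here refl))
                      (lits-agree {Θ = ⟦ pvar x ⟧ ∷ ⟦ P ⟧ ∷ []} (negated-off false) (λ _ → here refl)))
                    (closed v⁻)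

  eliminateAll : ∀ P xs → Closed P xs → [] ⊢₂ ⟦ P ⟧ ∷ []
  eliminateAll P []       closed = closed (λ _ → true)
  eliminateAll P (x ∷ xs) closed = eliminateAll P xs (eliminate P x xs closed)

  tautology : ∀ P → Tautology P → [] ⊢₂ ⟦ P ⟧ ∷ []
  tautology P taut = eliminateAll P (vars P) decided
    where
      decided : Closed P (vars P)
      decided v with evalP v P | taut v | kalmar v (vars P) P ⊆-refl
      ... | .true | refl | ⊢P = ⊢P

∪NE-assoc : ∀ s t u → (s ∪NE t) ∪NE u ≡ s ∪NE (t ∪NE u)
∪NE-assoc top    top    top    = refl
∪NE-assoc top    top    (b0 u) = refl
∪NE-assoc top    top    (b1 u) = refl
∪NE-assoc top    (b0 t) top    = refl
∪NE-assoc top    (b0 t) (b0 u) = refl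
∪NE-assoc top    (b0 t) (b1 u) = refl
∪NE-assoc top    (b1 t) top    = refl
∪NE-assoc top    (b1 t) (b0 u) = refl
∪NE-assoc top    (b1 t) (b1 u) = refl
∪NE-assoc (b0 s) top    top    = refl
∪NE-assoc (b0 s) top    (b0 u) = refl
∪NE-assoc (b0 s) top    (b1 u) = refl
∪NE-assoc (b0 s) (b0 t) top    = refl
∪NE-assoc (b0 s) (b0 t) (b0 u) = cong b0 (∪NE-assoc s t u)
∪NE-assoc (b0 s) (b0 t) (b1 u) = cong b1 (∪NE-assoc s t u)
∪NE-assoc (b0 s) (b1 t) top    = refl
∪NE-assoc (b0 s) (b1 t) (b0 u) = cong b1 (∪NE-assoc s t u)
∪NE-assoc (b0 s) (b1 t) (b1 u) = cong b1 (∪NE-assoc s t u)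
∪NE-assoc (b1 s) top    top    = refl
∪NE-assoc (b1 s) top    (b0 u) = refl
∪NE-assoc (b1 s) top    (b1 u) = refl
∪NE-assoc (b1 s) (b0 t) top    = refl
∪NE-assoc (b1 s) (b0 t) (b0 u) = cong b1 (∪NE-assoc s t u)
∪NE-assoc (b1 s) (b0 t) (b1 u) = cong b1 (∪NE-assoc s t u)
∪NE-assoc (b1 s) (b1 t) top    = refl
∪NE-assoc (b1 s) (b1 t) (b0 u) = cong b1 (∪NE-assoc s t u)
∪NE-assoc (b1 s) (b1 t) (b1 u) = cong b1 (∪NE-assoc s t u)

∪-assoc : ∀ S T U → (S ∪ T) ∪ U ≡ S ∪ (T ∪ U)
∪-assoc ∅      T      U      = refl
∪-assoc (ne s) ∅      U      = refl
∪-assoc (ne s) (ne t) ∅      = refl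
∪-assoc (ne s) (ne t) (ne u) = cong ne (∪NE-assoc s t u)

∪-identityʳ : ∀ S → S ∪ ∅ ≡ S
∪-identityʳ ∅      = refl
∪-identityʳ (ne s) = refl

⊕-assoc : ∀ s a b → (s ⊕ a) ⊕ b ≡ s ⊕ (a ⊕ b)
⊕-assoc ⟨ n , S ⟩ ⟨ m , T ⟩ ⟨ k , U ⟩ = cong₂ ⟨_,_⟩ (+-assoc n m k) (∪-assoc S T U)

⊕-identityʳ : ∀ s → s ⊕ pos₀ ≡ s
⊕-identityʳ ⟨ n , S ⟩ = cong₂ ⟨_,_⟩ (ℕ.+-identityʳ n) (∪-identityʳ S)

length : NE → ℕ
length top    = 1
length (b0 s) = suc (length s)
length (b1 s) = suc (length s)

memNE-beyond : ∀ s x → length s ≤ x → memNE x s ≡ false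
memNE-beyond top    (suc x) _       = refl
memNE-beyond (b0 s) (suc x) (s≤s h) = memNE-beyond s x h
memNE-beyond (b1 s) (suc x) (s≤s h) = memNE-beyond s x h

fresh : Pos → ℕ
fresh ⟨ _ , ∅ ⟩    = 0
fresh ⟨ _ , ne S ⟩ = length S

fresh-∉ : ∀ s → FreshPos (fresh s) s
fresh-∉ ⟨ _ , ∅ ⟩    = refl
fresh-∉ ⟨ _ , ne S ⟩ = memNE-beyond S (length S) ≤-refl

memNE-∪ˡ : ∀ x s t → memNE x (s ∪NE t) ≡ false → memNE x s ≡ false
memNE-∪ˡ zero    top    top    ()
memNE-∪ˡ zero    top    (b0 t) ()
memNE-∪ˡ zero    top    (b1 t) ()
memNE-∪ˡ (suc x) top    t      _ = refl
memNE-∪ˡ zero    (b0 s) t      _ = refl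
memNE-∪ˡ (suc x) (b0 s) top    e = e
memNE-∪ˡ (suc x) (b0 s) (b0 t) e = memNE-∪ˡ x s t e
memNE-∪ˡ (suc x) (b0 s) (b1 t) e = memNE-∪ˡ x s t e
memNE-∪ˡ zero    (b1 s) top    ()
memNE-∪ˡ zero    (b1 s) (b0 t) ()
memNE-∪ˡ zero    (b1 s) (b1 t) ()
memNE-∪ˡ (suc x) (b1 s) top    e = e
memNE-∪ˡ (suc x) (b1 s) (b0 t) e = memNE-∪ˡ x s t e
memNE-∪ˡ (suc x) (b1 s) (b1 t) e = memNE-∪ˡ x s t e

mem-∪ˡ : ∀ x S T → mem x (S ∪ T) ≡ false → mem x S ≡ false
mem-∪ˡ x ∅      T      _ = refl
mem-∪ˡ x (ne s) ∅      e = e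
mem-∪ˡ x (ne s) (ne t) e = memNE-∪ˡ x s t e

fresh-∉-⊕ : ∀ s a → FreshPos (fresh (s ⊕ a)) s
fresh-∉-⊕ s a = mem-∪ˡ (fresh (s ⊕ a)) (toks s) (toks a) (fresh-∉ (s ⊕ a))

axAt : ∀ A s t {r} → s ⊕ t ≡ r → (A ^ (s ⊕ t)) ∷ [] ⊢₂ (A ^ r) ∷ []
axAt A s t refl = ax A (s ⊕ t)

-- The axioms of LTL hold at every position.  Boxes on the right are
-- opened with a fresh token; boxes on the left are instantiated at the
-- offset that makes the positions of the two sides agree.

axiomA1 : ∀ A B s → [] ⊢₂ ((○ (A ⇒ B) ⇒ (○ A ⇒ ○ B)) ^ s) ∷ []
axiomA1 A B s = ⇒R (⇒R (○R (○L (exL {[]} (○L (⇒L (ax A (s ⊕ₙ 1)) (ax B (s ⊕ₙ 1))))))))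

axiomA2 : ∀ A s → [] ⊢₂ ((¬ᶠ (○ A) ⇒ ○ (¬ᶠ A)) ^ s) ∷ []
axiomA2 A s = ⇒R (○R (¬R (exL {[]} (¬L (○R (ax A (s ⊕ₙ 1)))))))

axiomA3 : ∀ A B s → [] ⊢₂ ((□ (A ⇒ B) ⇒ (□ A ⇒ □ B)) ^ s) ∷ []
axiomA3 A B s =
  ⇒R (⇒R (□R x (fresh-∉ s , fresh-∉ s ∷ fresh-∉ s ∷ [] , [])
    (□L ⟨ 0 , ⟅ x ⟆ ⟩ (exL {[]} (□L ⟨ 0 , ⟅ x ⟆ ⟩ (⇒L (ax A (s ⊕ₓ x)) (ax B (s ⊕ₓ x))))))))
  where x = fresh s

axiomA4 : ∀ A s → [] ⊢₂ ((□ A ⇒ A) ^ s) ∷ []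
axiomA4 A s = ⇒R (□L pos₀ (axAt A s pos₀ (⊕-identityʳ s)))

-- A5, A7: the offsets of the nested right boxes add up (⊕ is associative).
axiomA5 : ∀ A s → [] ⊢₂ ((□ A ⇒ □ (□ A)) ^ s) ∷ []
axiomA5 A s =
  ⇒R (□R x (fresh-∉ s , fresh-∉ s ∷ [] , [])
    (□R y (fresh-∉ (s ⊕ₓ x) , fresh-∉-⊕ s ⟨ 0 , ⟅ x ⟆ ⟩ ∷ [] , [])
      (□L (⟨ 0 , ⟅ x ⟆ ⟩ ⊕ ⟨ 0 , ⟅ y ⟆ ⟩) (axAt A s _ (sym (⊕-assoc s _ _))))))
  where x = fresh s
        y = fresh (s ⊕ₓ x)

axiomA6 : ∀ A s → [] ⊢₂ ((□ A ⇒ ○ A) ^ s) ∷ []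
axiomA6 A s = ⇒R (○R (□L ⟨ 1 , ∅ ⟩ (ax A (s ⊕ₙ 1))))

axiomA7 : ∀ A s → [] ⊢₂ ((□ A ⇒ ○ (□ A)) ^ s) ∷ []
axiomA7 A s =
  ⇒R (○R (□R x (fresh-∉ (s ⊕ₙ 1) , fresh-∉-⊕ s ⟨ 1 , ∅ ⟩ ∷ [] , [])
    (□L (⟨ 1 , ∅ ⟩ ⊕ ⟨ 0 , ⟅ x ⟆ ⟩) (axAt A s _ (sym (⊕-assoc s _ _))))))
  where x = fresh (s ⊕ₙ 1)

-- A8: after opening □A with a fresh x, IND (with the same token, which is
-- fresh for s and for □(A ⇒ ○A)^s) reduces A^(s ⊕ x) to the step
-- A^(s ⊕ x) ⊢ A^(s ⊕ x ⊕ 1), an instance of □(A ⇒ ○A).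
axiomA8 : ∀ A s → [] ⊢₂ (((A ∧ᶠ □ (A ⇒ ○ A)) ⇒ □ A) ^ s) ∷ []
axiomA8 A s =
  ⇒R (□R x (fresh-∉ s , fresh-∉ s ∷ [] , [])
    (cL (∧L₂ A (exL {[]} (∧L₁ (□ (A ⇒ ○ A))
      (IND x ⟨ 0 , ⟅ x ⟆ ⟩ (fresh-∉ s , fresh-∉ s ∷ [] , [])
        (exL {[]} (□L ⟨ 0 , ⟅ x ⟆ ⟩ (⇒L (ax A (s ⊕ₓ x)) (○L (ax A ((s ⊕ₓ x) ⊕ₙ 1))))))))))))
  where x = fresh s

modusPonens : ∀ {A B s} → [] ⊢₂ (A ^ s) ∷ [] → [] ⊢₂ ((A ⇒ B) ^ s) ∷ [] → [] ⊢₂ (B ^ s) ∷ []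
modusPonens {A} {B} {s} ⊢A ⊢A⇒B = cut ⊢A (cut ⊢A⇒B (⇒L (ax A s) (ax B s)))

embed : ∀ {A} → ⊢LTL A → ∀ s → [] ⊢₂ (A ^ s) ∷ []
embed (A0 P σ taut) s = Propositional.tautology σ s P taut
embed (A1 A B)      s = axiomA1 A B s
embed (A2 A)        s = axiomA2 A s
embed (A3 A B)      s = axiomA3 A B s
embed (A4 A)        s = axiomA4 A s
embed (A5 A)        s = axiomA5 A s
embed (A6 A)        s = axiomA6 A s
embed (A7 A)        s = axiomA7 A s
embed (A8 A)        s = axiomA8 A s
embed (MP ⊢A ⊢A⇒B)  s = modusPonens (embed ⊢A s) (embed ⊢A⇒B s)
embed (NEX ⊢A)      s = ○R (embed ⊢A (s ⊕ₙ 1))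
embed (NEC ⊢A)      s = □R (fresh s) (fresh-∉ s , [] , []) (embed ⊢A (s ⊕ₓ fresh s))

mainTheorem13 : (A : Form) → ⊢LTL A → [] ⊢₂ (A ^ pos₀) ∷ []
mainTheorem13 A ⊢A = embed ⊢A pos₀
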